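{- Let $S$ be a non-trivial strongly connected component of $G^+$. If there is an arc from a pair of $S$ to a pair $(x,y)\notin S$, then $\{(x,y)\}$ is a trivial strongly connected component of $G^+$ that is a sink. If there is an arc from a pair $(x,y)\notin S$ to a pair of $S$, then $\{(x,y)\}$ is a trivial strongly connected component of $G^+$ that is a source. In particular, if there is a directed path in $G^+$ from a non-trivial strongly connected component $S_1$ to a non-trivial strongly connected component $S_2$, then $S_1=S_2$.
   Context: $G$ is a connected graph with a given partition of $V(G)$ into independent sets (partite sets) $V_1,\dots,V_k$; $c(u)$ denotes the index of the partite set containing $u$. Let $\bar E=\{uv: u\in V_i, v\in V_j, i\neq j\}\setminus E(G)$. The pair-digraph $G^+$ has vertex set all ordered pairs $(u,v)$ with $u\ne v$ in $V(G)$, and arcs: (i) $(u,v)\to(u',v)$ whenever $c(u)=c(v)$, $uu'\in E(G)$, $vu'\notin E(G)$; (ii) $(u,v)\to(u',v)$ whenever $uu'\in E(G)$, $u'v\in\bar E$, and $u,v,u'$ lie in three different partite sets; (iii) $(u,v)\to(u,v')$ whenever $c(u)=c(v')$, $vv'\in E(G)$, $uv\notin E(G)$; (iv) $(u,v)\to(u,v')$ whenever $vv'\in E(G)$, $uv\in\bar E$, and $u,v,v'$ lie in three different partite sets. A strongly connected component is non-trivial if it contains more than one pair, trivial otherwise. A trivial component is a source if its unique pair has in-degree zero in $G^+$, and a sink if its unique pair has out-degree zero. -}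

module Defs where

open import Data.Nat using (ℕ)
open import Data.Fin using (Fin)
open import Data.Product using (Σ; ∃; _×_; _,_; proj₁; proj₂)
open import Relation.Nullary using (¬_)
open import Relation.Binary.PropositionalEquality using (_≡_; _≢_)
open import Relation.Binary.Construct.Closure.ReflexiveTransitive using (Star)
open import Level using (0ℓ; suc)

-- A connected simple graph on vertex set Fin n together with a partition of
-- the vertices into independent sets V_1,...,V_k, given by c : Fin n → Fin k
-- (c u = index of the partite set containing u).
record PartitionedGraph (n k : ℕ) : Set₁ where
  field
    E        : Fin n → Fin n → Set
    E-sym    : ∀ {u v} → E u v → E v u
    E-irrefl : ∀ {u} → ¬ E u u
    c        : Fin n → Fin k
    c-onto   : ∀ i → ∃ λ u → c u ≡ i
    indep    : ∀ {u v} → E u v → c u ≢ c v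
    connected : ∀ u v → Star E u v

module PairDigraph {n k : ℕ} (G : PartitionedGraph n k) where
  open PartitionedGraph G

  Ebar : Fin n → Fin n → Set
  Ebar u v = c u ≢ c v × ¬ E u v

  ThreeParts : Fin n → Fin n → Fin n → Set
  ThreeParts a b d = c a ≢ c b × c a ≢ c d × c b ≢ c d

  Pair : Set
  Pair = Fin n × Fin n

  -- an ordered pair (u,v) is a vertex of G⁺ iff u ≠ v
  Valid : Pair → Set
  Valid (u , v) = u ≢ v

  data Step : Pair → Pair → Set where
    arc-i   : ∀ {u v u'} → c u ≡ c v → E u u' → ¬ E v u' → Step (u , v) (u' , v)
    arc-ii  : ∀ {u v u'} → E u u' → Ebar u' v → ThreeParts u v u' → Step (u , v) (u' , v)
    arc-iii : ∀ {u v v'} → c u ≡ c v' → E v v' → ¬ E u v → Step (u , v) (u , v')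
    arc-iv  : ∀ {u v v'} → E v v' → Ebar u v → ThreeParts u v v' → Step (u , v) (u , v')

  Arc : Pair → Pair → Set
  Arc p q = Valid p × Valid q × Step p q

  Reach : Pair → Pair → Set
  Reach = Star Arc

  SameSCC : Pair → Pair → Set
  SameSCC p q = Reach p q × Reach q p

  NonTrivialSCC : Pair → Set
  NonTrivialSCC p = Valid p × ∃ λ q → Valid q × q ≢ p × SameSCC p q

  TrivialSCC : Pair → Set
  TrivialSCC p = Valid p × (∀ q → SameSCC p q → q ≡ p)

  Sink : Pair → Set
  Sink p = ∀ q → ¬ Arc p q

  Source : Pair → Set
  Source p = ∀ q → ¬ Arc q p

-- An arc p → q of G⁺ whose tail has an in-arc and whose head has an
-- out-arc can always be reversed by a directed path q ⇝ p.  By the symmetry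
-- (u , v) ↦ (v , u), which reverses arcs and exchanges kinds (i)/(iii) and
-- (ii)/(iv), it suffices to check arcs (u , v) → (u' , v) moving the first
-- coordinate; the in-arc of (u , v) then either yields the arc
-- (u' , v) → (u , v) directly or, if it is (u , w) → (u , v), the detour
-- (u' , v) → (u' , w) → (u , w) → (u , v).  Every pair of a non-trivial
-- component lies on a cycle, so it has in- and out-arcs; hence a pair reached
-- from the component that has an out-arc (or reaching it and having an
-- in-arc) returns to it, i.e. belongs to it.
module Submission where

open import Defs
open import Level using (_⊔_)
open import Data.Nat using (ℕ)
open import Data.Fin using (_≟_)
open import Data.Product using (_×_; ∃; _,_; proj₁; proj₂)
open import Data.Empty using (⊥-elim)
open import Function using (id)
open import Function.Bundles using (_⇔_; mk⇔)
open import Relation.Nullary using (¬_; yes; no)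
open import Relation.Binary.Core using (Rel)
open import Relation.Binary.PropositionalEquality
  using (_≡_; _≢_; refl; sym; trans; subst; ≢-sym)
open import Relation.Binary.Construct.Closure.ReflexiveTransitive
  using (Star; ε; _◅_; _◅◅_; gmap; reverse)

module Cycles {a ℓ} {A : Set a} (R : Rel A ℓ) where

  HasIn : A → Set (a ⊔ ℓ)
  HasIn p = ∃ λ r → R r p

  HasOut : A → Set (a ⊔ ℓ)
  HasOut p = ∃ λ t → R p t

  OnCycle : A → Set (a ⊔ ℓ)
  OnCycle p = ∃ λ q → R p q × Star R q p

  hasIn-forwards : ∀ {p q} → HasIn p → Star R p q → HasIn q
  hasIn-forwards hasIn ε        = hasIn
  hasIn-forwards _     (e ◅ es) = hasIn-forwards (_ , e) es

  hasOut-backwards : ∀ {p q} → Star R p q → HasOut q → HasOut p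
  hasOut-backwards ε       hasOut = hasOut
  hasOut-backwards (e ◅ _) _      = _ , e

  onCycle⇒hasIn : ∀ {p} → OnCycle p → HasIn p
  onCycle⇒hasIn {p} (_ , e , es) = hasIn-forwards (p , e) es

  onCycle⇒hasOut : ∀ {p} → OnCycle p → HasOut p
  onCycle⇒hasOut (q , e , _) = q , e

  onCycle-mutual : ∀ {p q} → OnCycle p → Star R p q → Star R q p → OnCycle q
  onCycle-mutual cyc _   ε        = cyc
  onCycle-mutual _   p⇝q (e ◅ es) = _ , e , es ◅◅ p⇝q

  onCycle-close : ∀ {p q} → Star R p q → R q p → OnCycle p
  onCycle-close ε        e = _ , e , ε
  onCycle-close (f ◅ fs) e = _ , f , fs ◅◅ e ◅ ε

  module Reversible (arc-reversible : ∀ {r p q t} → R r p → R p q → R q t → Star R q p) where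

    return-to-cycle : ∀ {p q} → OnCycle p → Star R p q → HasOut q → Star R q p
    return-to-cycle _   ε        _      = ε
    return-to-cycle cyc (e ◅ es) hasOut = return-to-cycle (onCycle-close back e) es hasOut ◅◅ back
      where back = arc-reversible (proj₂ (onCycle⇒hasIn cyc)) e (proj₂ (hasOut-backwards es hasOut))

    return-from-cycle : ∀ {p x} → OnCycle p → R x p → HasIn x → Star R p x
    return-from-cycle (_ , e , _) f (_ , g) = arc-reversible g f e

module PairDigraphProperties {n k : ℕ} (G : PartitionedGraph n k) where
  open PartitionedGraph G
  open PairDigraph G

  swap : Pair → Pair
  swap (u , v) = v , u

  ¬E-sym : ∀ {u v} → ¬ E u v → ¬ E v u
  ¬E-sym ¬uv vu = ¬uv (E-sym vu)

  Ebar-sym : ∀ {u v} → Ebar u v → Ebar v u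
  Ebar-sym (cu≢cv , ¬uv) = ≢-sym cu≢cv , ¬E-sym ¬uv

  step-swap : ∀ {p q} → Step p q → Step (swap q) (swap p)
  step-swap (arc-i   h e ¬e) = arc-iii (sym h) (E-sym e) ¬e
  step-swap (arc-ii  e eb (d₁ , d₂ , d₃)) = arc-iv (E-sym e) (Ebar-sym eb) (d₃ , ≢-sym d₁ , ≢-sym d₂)
  step-swap (arc-iii h e ¬e) = arc-i (sym h) (E-sym e) ¬e
  step-swap (arc-iv  e eb (d₁ , d₂ , d₃)) = arc-ii (E-sym e) (Ebar-sym eb) (≢-sym d₂ , ≢-sym d₃ , d₁)

  arc-swap : ∀ {p q} → Arc p q → Arc (swap q) (swap p)
  arc-swap (vp , vq , s) = ≢-sym vq , ≢-sym vp , step-swap s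

  reach-swap : ∀ {p q} → Reach p q → Reach (swap q) (swap p)
  reach-swap p⇝q = gmap swap id (reverse {U = λ x y → Arc (swap x) (swap y)} arc-swap p⇝q)

  second-move : ∀ {u v w} → Step (u , w) (u , v) → E w v × ¬ E u w × c u ≢ c w
  second-move (arc-i _ e _)             = ⊥-elim (E-irrefl e)
  second-move (arc-ii e _ _)            = ⊥-elim (E-irrefl e)
  second-move (arc-iii h e ¬e)          = e , ¬e , λ cu≡cw → indep e (trans (sym cu≡cw) h)
  second-move (arc-iv e (cu≢cw , ¬e) _) = e , ¬e , cu≢cw

  detour : ∀ {u v u' w} → Valid (u' , v) → E u u' → ¬ E u' v → c u' ≢ c v
         → Arc (u , w) (u , v) → Reach (u' , v) (u , v)
  detour {u} {v} {u'} {w} vq uu' ¬u'v cu'≢cv wv@(vw , _ , s) =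
    (vq , vu'w , proj₁ hops) ◅ (vu'w , vw , proj₂ hops) ◅ wv ◅ ε
    where
      w-v : E w v
      w-v = proj₁ (second-move s)
      ¬uw : ¬ E u w
      ¬uw = proj₁ (proj₂ (second-move s))
      cu≢cw : c u ≢ c w
      cu≢cw = proj₂ (proj₂ (second-move s))
      vu'w : Valid (u' , w)
      vu'w u'≡w = ¬u'v (subst (λ x → E x v) (sym u'≡w) w-v)
      hops : Step (u' , v) (u' , w) × Step (u' , w) (u , w)
      hops with c u' ≟ c w
      ... | yes same = arc-iii same (E-sym w-v) ¬u'v , arc-i same (E-sym uu') (¬E-sym ¬uw)
      ... | no diff  = arc-iv (E-sym w-v) (cu'≢cv , ¬u'v) (cu'≢cv , diff , λ eq → indep w-v (sym eq))
                     , arc-ii (E-sym uu') (cu≢cw , ¬uw) (diff , ≢-sym (indep uu') , ≢-sym cu≢cw)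

  arc-ii-back : ∀ {u v u'} → Valid (u' , v) → Valid (u , v) → E u u' → ¬ E u v → ThreeParts u v u'
              → Arc (u' , v) (u , v)
  arc-ii-back vq vp uu' ¬uv (d₁ , d₂ , d₃) =
    vq , vp , arc-ii (E-sym uu') (d₁ , ¬uv) (≢-sym d₃ , ≢-sym d₂ , ≢-sym d₁)

  arc-i-reversible : ∀ {r u v u'} → Arc r (u , v) → Valid (u' , v) → c u ≡ c v → E u u' → ¬ E v u'
                   → Reach (u' , v) (u , v)
  arc-i-reversible (_ , _ , arc-i h' e' _) _ h _ _ = ⊥-elim (indep e' (trans h' (sym h)))
  arc-i-reversible (_ , _ , arc-ii _ _ (_ , _ , d₃)) _ h _ _ = ⊥-elim (d₃ (sym h))
  arc-i-reversible rp@(_ , _ , arc-iii _ _ _) vq h uu' ¬vu' =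
    detour vq uu' (¬E-sym ¬vu') (λ eq → indep uu' (trans h (sym eq))) rp
  arc-i-reversible (_ , _ , arc-iv _ _ (_ , d₂ , _)) _ h _ _ = ⊥-elim (d₂ h)

  arc-ii-reversible : ∀ {r u v u'} → Arc r (u , v) → Valid (u' , v) → E u u' → Ebar u' v
                    → ThreeParts u v u' → Reach (u' , v) (u , v)
  arc-ii-reversible (_ , vp , arc-i _ _ ¬vu) vq uu' _ th = arc-ii-back vq vp uu' (¬E-sym ¬vu) th ◅ ε
  arc-ii-reversible (_ , vp , arc-ii _ (_ , ¬uv) _) vq uu' _ th = arc-ii-back vq vp uu' ¬uv th ◅ ε
  arc-ii-reversible (_ , _ , arc-iii h _ _) _ _ _ (d₁ , _) = ⊥-elim (d₁ h)
  arc-ii-reversible rp@(_ , _ , arc-iv _ _ _) vq uu' (cu'≢cv , ¬u'v) _ = detour vq uu' ¬u'v cu'≢cv rp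

  arc-reversible : ∀ {r p q t} → Arc r p → Arc p q → Arc q t → Reach q p
  arc-reversible rp (_ , vq , arc-i h e ¬e) _ = arc-i-reversible rp vq h e ¬e
  arc-reversible rp (_ , vq , arc-ii e eb th) _ = arc-ii-reversible rp vq e eb th
  arc-reversible _ (vp , _ , arc-iii h e ¬e) qt =
    reach-swap (arc-i-reversible (arc-swap qt) (≢-sym vp) (sym h) (E-sym e) ¬e)
  arc-reversible _ (vp , _ , arc-iv e eb (d₁ , d₂ , d₃)) qt =
    reach-swap (arc-ii-reversible (arc-swap qt) (≢-sym vp) (E-sym e) (Ebar-sym eb) (≢-sym d₂ , ≢-sym d₃ , d₁))

  open Cycles Arc
  open Reversible arc-reversible

  sameSCC-sym : ∀ {p q} → SameSCC p q → SameSCC q p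
  sameSCC-sym (p⇝q , q⇝p) = q⇝p , p⇝q

  sameSCC-trans : ∀ {p q r} → SameSCC p q → SameSCC q r → SameSCC p r
  sameSCC-trans (p⇝q , q⇝p) (q⇝r , r⇝q) = p⇝q ◅◅ q⇝r , r⇝q ◅◅ q⇝p

  nonTrivialSCC⇒onCycle : ∀ {s} → NonTrivialSCC s → OnCycle s
  nonTrivialSCC⇒onCycle (_ , _ , _ , q≢s , ε , _)        = ⊥-elim (q≢s refl)
  nonTrivialSCC⇒onCycle (_ , _ , _ , _ , e ◅ es , q⇝s) = _ , e , es ◅◅ q⇝s

  sameSCC-onCycle : ∀ {s p} → NonTrivialSCC s → SameSCC s p → OnCycle p
  sameSCC-onCycle nt (s⇝p , p⇝s) = onCycle-mutual (nonTrivialSCC⇒onCycle nt) s⇝p p⇝s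

  sink-trivial : ∀ {x} → Sink x → ∀ q → SameSCC x q → q ≡ x
  sink-trivial _    _ (ε , _)     = refl
  sink-trivial sink _ (e ◅ _ , _) = ⊥-elim (sink _ e)

  source-trivial : ∀ {x} → Source x → ∀ q → SameSCC x q → q ≡ x
  source-trivial _      _ (_ , ε)      = refl
  source-trivial source _ (_ , e ◅ es) = ⊥-elim (source _ (proj₂ (hasIn-forwards (_ , e) es)))

  exit-trivial-sink : ∀ s a x → NonTrivialSCC s → SameSCC s a → Arc a x → ¬ SameSCC s x
                    → TrivialSCC x × Sink x
  exit-trivial-sink s a x nt s~a ax s≁x = (proj₁ (proj₂ ax) , sink-trivial sink) , sink
    where
      sink : Sink x
      sink y xy = s≁x ( proj₁ s~a ◅◅ ax ◅ ε
                      , return-to-cycle (sameSCC-onCycle nt s~a) (ax ◅ ε) (y , xy) ◅◅ proj₂ s~a)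

  entry-trivial-source : ∀ s a x → NonTrivialSCC s → SameSCC s a → Arc x a → ¬ SameSCC s x
                       → TrivialSCC x × Source x
  entry-trivial-source s a x nt s~a xa s≁x = (proj₁ xa , source-trivial source) , source
    where
      source : Source x
      source y yx = s≁x ( proj₁ s~a ◅◅ return-from-cycle (sameSCC-onCycle nt s~a) xa (y , yx)
                        , xa ◅ proj₂ s~a)

  reach-nonTrivialSCC-same : ∀ s₁ s₂ a b → NonTrivialSCC s₁ → NonTrivialSCC s₂
                           → SameSCC s₁ a → SameSCC s₂ b → Reach a b
                           → ∀ q → SameSCC s₁ q ⇔ SameSCC s₂ q
  reach-nonTrivialSCC-same s₁ s₂ a b nt₁ nt₂ s₁~a s₂~b a⇝b _ =
    mk⇔ (sameSCC-trans (sameSCC-sym s₁~s₂)) (sameSCC-trans s₁~s₂)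
    where
      b⇝a : Reach b a
      b⇝a = return-to-cycle (sameSCC-onCycle nt₁ s₁~a) a⇝b (onCycle⇒hasOut (sameSCC-onCycle nt₂ s₂~b))
      s₁~s₂ : SameSCC s₁ s₂
      s₁~s₂ = sameSCC-trans (sameSCC-trans s₁~a (a⇝b , b⇝a)) (sameSCC-sym s₂~b)

corollary1 : ∀ {n k} (G : PartitionedGraph n k) → let open PairDigraph G in
    (∀ s a x → NonTrivialSCC s → SameSCC s a → Arc a x → ¬ SameSCC s x → TrivialSCC x × Sink x)
    × (∀ s a x → NonTrivialSCC s → SameSCC s a → Arc x a → ¬ SameSCC s x → TrivialSCC x × Source x)
    × (∀ s₁ s₂ a b → NonTrivialSCC s₁ → NonTrivialSCC s₂ → SameSCC s₁ a → SameSCC s₂ b → Reach a b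
        → ∀ q → SameSCC s₁ q ⇔ SameSCC s₂ q)
corollary1 G = exit-trivial-sink , entry-trivial-source , reach-nonTrivialSCC-same
  where open PairDigraphProperties G
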